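{- For $p \in \{3, 5\}$, $f(\mathrm{Hol}(\mathbb{Z}_p)) = p$.
   Context: For an odd prime $p$, $\mathrm{Hol}(\mathbb{Z}_p) = \langle x, y \mid x^p = y^{p-1} = 1,\ x^g y = yx\rangle$, where $g$ has multiplicative order $p-1$ modulo $p$. For a finite group $G$: a sequence in $G$ is a tuple $S=(a_1,\dots,a_n)$ of elements of $G$ (repetition allowed); a subsequence is obtained by choosing a nonempty subset of the index set. $S$ is a product-one sequence if $a_{\sigma(1)}\cdots a_{\sigma(n)}=1$ for some permutation $\sigma$. The Davenport constant $d(G)$ is the smallest positive integer $m$ such that every sequence in $G$ of length $m$ has a product-one subsequence. $f(G)$ is the smallest positive integer $m$ such that every sequence in $G$ of length $d(G)$ has a product-one subsequence of length at most $m$. -}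

module Defs where

open import Data.Nat using (ℕ; _+_; _*_; _≤_; _<_; NonZero)
open import Data.Nat.DivMod using (_%_)
open import Data.Product using (_×_; _,_; ∃-syntax)
open import Data.List using (List; foldr; length)
open import Data.List.Relation.Unary.All using (All)
open import Data.List.Relation.Binary.Sublist.Propositional using (_⊆_)
open import Data.List.Relation.Binary.Permutation.Propositional using (_↭_)
open import Relation.Binary.PropositionalEquality using (_≡_)

module ProductOneTheory {A : Set} (Elem : A → Set) (_∙_ : A → A → A) (e : A) where

  prod : List A → A
  prod = foldr _∙_ e

  ProductOne : List A → Set
  ProductOne T = ∃[ U ] (U ↭ T × prod U ≡ e)

  -- subsequence = nonempty choice of indices = nonempty sublist
  -- (order is irrelevant since ProductOne allows any permutation)
  HasProductOneSubseq : List A → Set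
  HasProductOneSubseq S = ∃[ T ] (T ⊆ S × 1 ≤ length T × ProductOne T)

  DavenportProp : ℕ → Set
  DavenportProp m = ∀ S → All Elem S → length S ≡ m → HasProductOneSubseq S

  IsDavenport : ℕ → Set
  IsDavenport d = 1 ≤ d × DavenportProp d × (∀ m → 1 ≤ m → DavenportProp m → d ≤ m)

  ShortProp : ℕ → ℕ → Set
  ShortProp d k = ∀ S → All Elem S → length S ≡ d →
    ∃[ T ] (T ⊆ S × 1 ≤ length T × length T ≤ k × ProductOne T)

  IsF : ℕ → ℕ → Set
  IsF d f = 1 ≤ f × ShortProp d f × (∀ k → 1 ≤ k → ShortProp d k → f ≤ k)

-- Hol(ℤ_p) realised as the affine group {t ↦ a t + b : a ∈ ℤ_p^×, b ∈ ℤ_p}.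

module _ (p : ℕ) .{{_ : NonZero p}} where

  HolElem : ℕ × ℕ → Set
  HolElem (a , b) = 1 ≤ a × a < p × b < p

  -- (a , b)(c , d) = (a c , a d + b)   (composition of affine maps)
  holMul : ℕ × ℕ → ℕ × ℕ → ℕ × ℕ
  holMul (a , b) (c , d) = ((a * c) % p , (a * d + b) % p)

  holOne : ℕ × ℕ
  holOne = (1 , 0)

  DavenportHol : ℕ → Set
  DavenportHol = ProductOneTheory.IsDavenport HolElem holMul holOne

  FHol : ℕ → ℕ → Set
  FHol = ProductOneTheory.IsF HolElem holMul holOne

-- Write x = (1 , 1) and y = (2 , 0).  The first coordinate of a product of x's and y's
-- is 2^(number of y's) mod p, so when 2 has order greater than j modulo p, a product-one
-- subsequence of x^m y^j consists of x's only; as x^k = (1 , k mod p), it has between p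
-- and m terms.  For p ∈ {3, 5} the element 2 is a primitive root, so j = p - 2 is
-- allowed: x^(p-1) y^(p-2) shows d ≥ 2p - 2, and x^p y^(p-2) shows f ≥ p.  Conversely,
-- every sequence of length 2p - 2 has a product-one subsequence of length at most p,
-- which is checked by an exhaustive search over multisets of group elements.
module Submission where

open import Defs
open import Data.Bool using (Bool; true; T; _∧_; _∨_; if_then_else_)
open import Data.Bool.Properties using (T-∧; T-∨)
open import Data.Empty using (⊥-elim)
open import Data.List
  using (List; []; _∷_; _++_; _ʳ++_; length; map; concatMap; filter; replicate; take)
open import Data.List.Properties
  using (++-identityʳ; length-map; length-++; length-replicate; length-take; filter-all)
open import Data.List.Relation.Unary.All using (All; []; _∷_)
open import Data.List.Relation.Unary.All.Properties using (++⁺; replicate⁺; take⁺)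
open import Data.List.Relation.Unary.Linked using (Linked; []; [-]; _∷_)
open import Data.List.Relation.Binary.Permutation.Propositional
  using (_↭_; refl; prep; swap; trans; ↭-sym)
open import Data.List.Relation.Binary.Permutation.Propositional.Properties
  using (↭-length; All-resp-↭; filter-↭; ++↭ʳ++; map⁺)
open import Data.List.Relation.Binary.Sublist.Propositional
  using (_⊆_; []; _∷_; _∷ʳ_; minimum; ⊆-trans)
open import Data.List.Relation.Binary.Sublist.Propositional.Properties
  using (All-resp-⊆; filter⁺; length-mono-≤; take-⊆)
open import Data.Maybe using (Maybe; just; nothing; is-just)
open import Data.Nat
  using (ℕ; zero; suc; pred; _+_; _*_; _^_; _∸_; _≤_; _<_; z≤n; s≤s; NonZero; >-nonZero;
         _≤?_; _≟_; _≡ᵇ_)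
open import Data.Nat.Properties
  using (≤-trans; ≤-antisym; <⇒≤; <⇒≱; <-≤-trans; ≰⇒>; ≤∧≢⇒<; ≤-pred; m≤pred[n]⇒suc[m]≤n;
         pred-mono-≤; suc-pred; suc-injective; +-suc; +-comm; +-identityʳ; *-identityˡ; m≤m+n;
         m+[n∸m]≡n; m≤n⇒m⊓n≡m; +-monoˡ-<; *-monoˡ-≤; ≤-decTotalOrder)
open import Data.Nat.DivMod
  using (_%_; _/_; m%n%n≡m%n; [m+kn]%n≡m%n; m<n⇒m%n≡m; %-distribˡ-+; %-distribˡ-*;
         m<n⇒m/n≡0; m*n/n≡m; +-distrib-/-∣ʳ)
open import Data.Nat.Divisibility using (n∣m*n; m%n≡0⇒n∣m; ∣⇒≤)
open import Data.List.Sort ≤-decTotalOrder using (sort; sort-↭; sort-↗)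
open import Data.Product using (_×_; _,_; ∃-syntax; proj₁; proj₂)
open import Data.Product.Properties using (≡-dec)
open import Data.Sum using (_⊎_; inj₁; inj₂)
open import Function using (_∘_)
open import Function.Bundles using (Equivalence)
open import Relation.Binary.Definitions using (DecidableEquality)
open import Relation.Binary.PropositionalEquality
  using (_≡_; refl; sym; cong; cong₂; subst; module ≡-Reasoning)
  renaming (trans to ≡-trans)
open import Relation.Nullary using (yes; no)

⊆-↭⇒↭-⊆ : {A : Set} {T S′ S : List A} → T ⊆ S′ → S′ ↭ S → ∃[ T′ ] (T′ ↭ T × T′ ⊆ S)
⊆-↭⇒↭-⊆ q refl = _ , refl , q
⊆-↭⇒↭-⊆ (x ∷ʳ q) (prep x r) with ⊆-↭⇒↭-⊆ q r
... | T′ , r′ , q′ = T′ , r′ , x ∷ʳ q′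
⊆-↭⇒↭-⊆ (refl ∷ q) (prep x r) with ⊆-↭⇒↭-⊆ q r
... | T′ , r′ , q′ = x ∷ T′ , prep x r′ , refl ∷ q′
⊆-↭⇒↭-⊆ (x ∷ʳ (y ∷ʳ q)) (swap x y r) with ⊆-↭⇒↭-⊆ q r
... | T′ , r′ , q′ = T′ , r′ , y ∷ʳ (x ∷ʳ q′)
⊆-↭⇒↭-⊆ (x ∷ʳ (refl ∷ q)) (swap x y r) with ⊆-↭⇒↭-⊆ q r
... | T′ , r′ , q′ = y ∷ T′ , prep y r′ , refl ∷ (x ∷ʳ q′)
⊆-↭⇒↭-⊆ (refl ∷ (y ∷ʳ q)) (swap x y r) with ⊆-↭⇒↭-⊆ q r
... | T′ , r′ , q′ = x ∷ T′ , prep x r′ , y ∷ʳ (refl ∷ q′)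
⊆-↭⇒↭-⊆ (refl ∷ (refl ∷ q)) (swap x y r) with ⊆-↭⇒↭-⊆ q r
... | T′ , r′ , q′ = y ∷ x ∷ T′ , swap y x r′ , refl ∷ (refl ∷ q′)
⊆-↭⇒↭-⊆ q (trans r₁ r₂) with ⊆-↭⇒↭-⊆ q r₁
... | T₁ , s₁ , q₁ with ⊆-↭⇒↭-⊆ q₁ r₂
... | T₂ , s₂ , q₂ = T₂ , trans s₂ s₁ , q₂

from-is-just : {A : Set} (m : Maybe A) → T (is-just m) → A
from-is-just (just a) _ = a

module ProductOneFacts {A : Set} (Elem : A → Set) (_∙_ : A → A → A) (e : A) where
  open ProductOneTheory Elem _∙_ e

  IsDavenport-unique : ∀ {d d′} → IsDavenport d → IsDavenport d′ → d ≡ d′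
  IsDavenport-unique (1≤d , D , least) (1≤d′ , D′ , least′) = ≤-antisym (least _ 1≤d′ D′) (least′ _ 1≤d D)

  HasShortProductOneSubseq : ℕ → List A → Set
  HasShortProductOneSubseq k S = ∃[ T ] (T ⊆ S × 1 ≤ length T × length T ≤ k × ProductOne T)

  ShortProp⇒DavenportProp : ∀ {d k} → ShortProp d k → DavenportProp d
  ShortProp⇒DavenportProp short S ES |S| with short S ES |S|
  ... | T , q , 1≤|T| , _ , po = T , q , 1≤|T| , po

  short-∷ : ∀ {k} a {S} → HasShortProductOneSubseq k S → HasShortProductOneSubseq k (a ∷ S)
  short-∷ a (T , q , rest) = T , a ∷ʳ q , rest

  short-↭ : ∀ {k S S′} → S ↭ S′ → HasShortProductOneSubseq k S → HasShortProductOneSubseq k S′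
  short-↭ r (T , q , 1≤|T| , |T|≤k , U , U↭T , prodU) with ⊆-↭⇒↭-⊆ q r
  ... | T′ , T′↭T , q′ =
    T′ , q′ , subst (1 ≤_) |T|≡|T′| 1≤|T| , subst (_≤ _) |T|≡|T′| |T|≤k ,
    U , trans U↭T (↭-sym T′↭T) , prodU
    where |T|≡|T′| = sym (↭-length T′↭T)

  -- The first factor stays in front because a
  -- rotation of a product-one ordering is again product-one, so no product-one sequence
  -- satisfying plausible is missed.
  module Search (_≟ᴬ_ : DecidableEquality A) (plausible : List A → Bool) (k : ℕ) where

    insertions : (a : A) (S : List A) → List (∃[ S′ ] S′ ↭ a ∷ S)
    insertions a [] = (a ∷ [] , refl) ∷ []
    insertions a (b ∷ S) =
      (a ∷ b ∷ S , refl) ∷ map (λ { (S′ , r) → b ∷ S′ , trans (prep b r) (swap b a refl) }) (insertions a S)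

    permutations : (S : List A) → List (∃[ S′ ] S′ ↭ S)
    permutations [] = ([] , refl) ∷ []
    permutations (a ∷ S) =
      concatMap (λ { (S′ , r) → map (λ { (S″ , r′) → S″ , trans r′ (prep a r) }) (insertions a S′) })
                (permutations S)

    firstProductOne : (a : A) (S : List A) → List (∃[ S′ ] S′ ↭ S) → Maybe (ProductOne (a ∷ S))
    firstProductOne a S [] = nothing
    firstProductOne a S ((S′ , r) ∷ rest) with prod (a ∷ S′) ≟ᴬ e
    ... | yes prod≡e = just (a ∷ S′ , prep a r , prod≡e)
    ... | no _ = firstProductOne a S rest

    productOne? : (S : List A) → Maybe (ProductOne S)
    productOne? [] = nothing
    productOne? (a ∷ S) = if plausible (a ∷ S) then firstProductOne a S (permutations S) else nothing

    sublistsUpTo : ℕ → (S : List A) → List (∃[ T ] T ⊆ S)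
    sublistsUpTo n [] = ([] , []) ∷ []
    sublistsUpTo zero (a ∷ S) = ([] , minimum (a ∷ S)) ∷ []
    sublistsUpTo (suc n) (a ∷ S) =
      map (λ { (T , q) → a ∷ T , refl ∷ q }) (sublistsUpTo n S) ++
      map (λ { (T , q) → T , a ∷ʳ q }) (sublistsUpTo (suc n) S)

    firstShort : {S : List A} → List (∃[ T ] T ⊆ S) → Maybe (HasShortProductOneSubseq k S)
    firstShort [] = nothing
    firstShort ((T , q) ∷ rest) with 1 ≤? length T | length T ≤? k | productOne? T
    ... | yes 1≤|T| | yes |T|≤k | just po = just (T , q , 1≤|T| , |T|≤k , po)
    ... | _ | _ | _ = firstShort rest

    -- Only subsequences through the head are tried: the enumeration below has already
    -- examined every subsequence of the tail.
    shortThroughHead? : (S : List A) → Maybe (HasShortProductOneSubseq k S)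
    shortThroughHead? [] = nothing
    shortThroughHead? (a ∷ S) = firstShort (map (λ { (T , q) → a ∷ T , refl ∷ q }) (sublistsUpTo (k ∸ 1) S))

-- Checks P on all multisets of n codes below N by walking the tree of their sorted code
-- lists (acc is the reversed prefix, lo its last code), cutting a branch as soon as check
-- succeeds on its prefix.
module MultisetEnumeration {A : Set} (P : List A → Set) (P-∷ : ∀ a {S} → P S → P (a ∷ S))
                           (check : (S : List A) → Maybe (P S)) (decode : ℕ → A) (N : ℕ) where

  mutual
    allExtensions : ℕ → List ℕ → ℕ → Bool
    allExtensions lo acc zero = is-just (check (map decode acc))
    allExtensions lo acc (suc n) = is-just (check (map decode acc)) ∨ allExtensionsFrom acc n lo (N ∸ lo)

    allExtensionsFrom : List ℕ → ℕ → ℕ → ℕ → Bool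
    allExtensionsFrom acc n c zero = true
    allExtensionsFrom acc n c (suc k) = allExtensions c (c ∷ acc) n ∧ allExtensionsFrom acc n (suc c) k

  P-ʳ++ : ∀ R {S} → P S → P (R ʳ++ S)
  P-ʳ++ [] pS = pS
  P-ʳ++ (a ∷ R) pS = P-ʳ++ R (P-∷ a pS)

  allExtensionsFrom-sound : ∀ acc n c k → T (allExtensionsFrom acc n c k) →
                            ∀ x → c ≤ x → x < c + k → T (allExtensions x (x ∷ acc) n)
  allExtensionsFrom-sound acc n c zero _ x c≤x x<c+0 = ⊥-elim (<⇒≱ (subst (x <_) (+-identityʳ c) x<c+0) c≤x)
  allExtensionsFrom-sound acc n c (suc k) ok x c≤x x<c+1+k with x ≟ c | Equivalence.to T-∧ ok
  ... | yes refl | here , _ = here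
  ... | no x≢c | _ , later =
    allExtensionsFrom-sound acc n (suc c) k later x (≤∧≢⇒< c≤x (x≢c ∘ sym)) (subst (x <_) (+-suc c k) x<c+1+k)

  allExtensions-sound : ∀ lo acc n → T (allExtensions lo acc n) →
                        ∀ R → Linked _≤_ (lo ∷ R) → All (_< N) R → length R ≡ n →
                        P (map decode R ʳ++ map decode acc)
  allExtensions-sound lo acc zero ok [] _ _ _ = from-is-just (check (map decode acc)) ok
  allExtensions-sound lo acc (suc n) ok R sorted bounded |R| with Equivalence.to T-∨ ok
  ... | inj₁ found = P-ʳ++ (map decode R) (from-is-just (check (map decode acc)) found)
  allExtensions-sound lo acc (suc n) ok (x ∷ R) (lo≤x ∷ sorted) (x<N ∷ bounded) |R| | inj₂ later =
    allExtensions-sound x (x ∷ acc) n (allExtensionsFrom-sound acc n lo (N ∸ lo) later x lo≤x x<lo+[N∸lo])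
      R sorted bounded (suc-injective |R|)
    where x<lo+[N∸lo] = subst (x <_) (sym (m+[n∸m]≡n (≤-trans lo≤x (<⇒≤ x<N)))) x<N

  every-multiset : (P-↭ : ∀ {S S′} → S ↭ S′ → P S → P S′) → ∀ n → T (allExtensions 0 [] n) →
                   ∀ C → All (_< N) C → length C ≡ n → P (map decode C)
  every-multiset P-↭ n ok C bounded |C| =
    P-↭ sorted↭C (allExtensions-sound 0 [] n ok (sort C) (0∷-sorted (sort-↗ C))
                   (All-resp-↭ (↭-sym (sort-↭ C)) bounded) (≡-trans (↭-length (sort-↭ C)) |C|))
    where
    0∷-sorted : ∀ {R} → Linked _≤_ R → Linked _≤_ (0 ∷ R)
    0∷-sorted [] = [-]
    0∷-sorted [-] = z≤n ∷ [-]
    0∷-sorted (r ∷ rs) = z≤n ∷ r ∷ rs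
    sorted↭C : map decode (sort C) ʳ++ [] ↭ map decode C
    sorted↭C = trans (↭-sym (++↭ʳ++ (map decode (sort C)) []))
                     (subst (_↭ map decode C) (sym (++-identityʳ _)) (map⁺ decode (sort-↭ C)))

module ModularArithmetic (d : ℕ) .{{_ : NonZero d}} where
  open ≡-Reasoning

  m*[n%d]%d≡m*n%d : ∀ m n → m * (n % d) % d ≡ m * n % d
  m*[n%d]%d≡m*n%d m n = begin
    m * (n % d) % d           ≡⟨ %-distribˡ-* m (n % d) d ⟩
    m % d * (n % d % d) % d   ≡⟨ cong (λ k → m % d * k % d) (m%n%n≡m%n n d) ⟩
    m % d * (n % d) % d       ≡⟨ %-distribˡ-* m n d ⟨
    m * n % d                 ∎

  [m%d+n]%d≡[m+n]%d : ∀ m n → (m % d + n) % d ≡ (m + n) % d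
  [m%d+n]%d≡[m+n]%d m n = begin
    (m % d + n) % d           ≡⟨ %-distribˡ-+ (m % d) n d ⟩
    (m % d % d + n % d) % d   ≡⟨ cong (λ k → (k + n % d) % d) (m%n%n≡m%n m d) ⟩
    (m % d + n % d) % d       ≡⟨ %-distribˡ-+ m n d ⟨
    (m + n) % d               ∎

  n%d≡0⇒d≤n : ∀ n .{{_ : NonZero n}} → n % d ≡ 0 → d ≤ n
  n%d≡0⇒d≤n n n%d≡0 = ∣⇒≤ (m%n≡0⇒n∣m n d n%d≡0)

_≟ₕ_ : DecidableEquality (ℕ × ℕ)
_≟ₕ_ = ≡-dec _≟_ _≟_

module HolSearch (p : ℕ) .{{_ : NonZero p}} where
  open ProductOneTheory (HolElem p) (holMul p) (holOne p)
  open ProductOneFacts (HolElem p) (holMul p) (holOne p)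

  -- The first coordinate is a homomorphism to the abelian group ℤ_p^×, so it is 1 on
  -- the product of any product-one sequence.
  firstCoordinateProduct : List (ℕ × ℕ) → ℕ
  firstCoordinateProduct [] = 1
  firstCoordinateProduct ((a , _) ∷ S) = a * firstCoordinateProduct S % p

  plausible : List (ℕ × ℕ) → Bool
  plausible S = firstCoordinateProduct S ≡ᵇ 1

  decode : ℕ → ℕ × ℕ
  decode c = suc (c / p) , c % p

  decode-surjective : ∀ {u} → HolElem p u → ∃[ c ] (c < pred p * p × decode c ≡ u)
  decode-surjective {suc a , b} (_ , 1+a<p , b<p) = b + a * p , c<N , cong₂ _,_ (cong suc quotient) remainder
    where
    open ≡-Reasoning
    c<N : b + a * p < pred p * p
    c<N = <-≤-trans (+-monoˡ-< (a * p) b<p) (*-monoˡ-≤ p (pred-mono-≤ 1+a<p))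
    quotient : (b + a * p) / p ≡ a
    quotient = begin
      (b + a * p) / p      ≡⟨ +-distrib-/-∣ʳ b (n∣m*n a) ⟩
      b / p + a * p / p    ≡⟨ cong₂ _+_ (m<n⇒m/n≡0 b<p) (m*n/n≡m a p) ⟩
      a                    ∎
    remainder : (b + a * p) % p ≡ b
    remainder = ≡-trans ([m+kn]%n≡m%n b a p) (m<n⇒m%n≡m b<p)

  codes : ∀ {S} → All (HolElem p) S → ∃[ C ] (map decode C ≡ S × All (_< pred p * p) C)
  codes [] = [] , refl , []
  codes (u∈G ∷ S∈G) with decode-surjective u∈G | codes S∈G
  ... | c , c<N , refl | C , refl , C<N = c ∷ C , refl , c<N ∷ C<N

  module Enumeration (k : ℕ) = MultisetEnumeration (HasShortProductOneSubseq k) short-∷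
    (Search.shortThroughHead? _≟ₕ_ plausible k) decode (pred p * p)

  everyMultisetHasShort : (d k : ℕ) → Bool
  everyMultisetHasShort d k = Enumeration.allExtensions k 0 [] d

  shortProp-by-enumeration : ∀ d k → T (everyMultisetHasShort d k) → ShortProp d k
  shortProp-by-enumeration d k ok S S∈G |S| with codes S∈G
  ... | C , refl , C<N = Enumeration.every-multiset k short-↭ d ok C C<N (≡-trans (sym (length-map decode C)) |S|)

OrderOf2Above : (p : ℕ) .{{_ : NonZero p}} → ℕ → Set
OrderOf2Above p j = ∀ {k} → k ≤ j → 2 ^ k % p ≡ 1 → k ≡ 0

module HolLowerBound (p : ℕ) .{{_ : NonZero p}} (2<p : 2 < p) where
  open ProductOneTheory (HolElem p) (holMul p) (holOne p)
  open ModularArithmetic p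
  open ≡-Reasoning

  1<p : 1 < p
  1<p = <⇒≤ 2<p

  x y : ℕ × ℕ
  x = 1 , 1
  y = 2 , 0

  xᵐyʲ : ℕ → ℕ → List (ℕ × ℕ)
  xᵐyʲ m j = replicate m x ++ replicate j y

  xᵐyʲ-∈G : ∀ m j → All (HolElem p) (xᵐyʲ m j)
  xᵐyʲ-∈G m j =
    ++⁺ (replicate⁺ m (s≤s z≤n , 1<p , 1<p)) (replicate⁺ j (s≤s z≤n , 2<p , ≤-trans (s≤s z≤n) 2<p))

  length-xᵐyʲ : ∀ m j → length (xᵐyʲ m j) ≡ m + j
  length-xᵐyʲ m j = ≡-trans (length-++ (replicate m x)) (cong₂ _+_ (length-replicate m) (length-replicate j))

  XorY : ℕ × ℕ → Set
  XorY u = u ≡ x ⊎ u ≡ y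

  xᵐyʲ-XorY : ∀ m j → All XorY (xᵐyʲ m j)
  xᵐyʲ-XorY m j = ++⁺ (replicate⁺ m (inj₁ refl)) (replicate⁺ j (inj₂ refl))

  occurrences : ℕ × ℕ → List (ℕ × ℕ) → ℕ
  occurrences g S = length (filter (_≟ₕ g) S)

  occurrences-⊆ : ∀ g {S S′} → S ⊆ S′ → occurrences g S ≤ occurrences g S′
  occurrences-⊆ g q = length-mono-≤ (filter⁺ (_≟ₕ g) (_≟ₕ g) (λ { refl u≡g → u≡g }) q)

  occurrences-↭ : ∀ g {S S′} → S ↭ S′ → occurrences g S ≡ occurrences g S′
  occurrences-↭ g r = ↭-length (filter-↭ (_≟ₕ g) r)

  occurrences-x-xᵐyʲ : ∀ m j → occurrences x (xᵐyʲ m j) ≡ m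
  occurrences-x-xᵐyʲ zero zero = refl
  occurrences-x-xᵐyʲ zero (suc j) = occurrences-x-xᵐyʲ zero j
  occurrences-x-xᵐyʲ (suc m) j = cong suc (occurrences-x-xᵐyʲ m j)

  occurrences-y-xᵐyʲ : ∀ m j → occurrences y (xᵐyʲ m j) ≡ j
  occurrences-y-xᵐyʲ zero zero = refl
  occurrences-y-xᵐyʲ zero (suc j) = cong suc (occurrences-y-xᵐyʲ zero j)
  occurrences-y-xᵐyʲ (suc m) j = occurrences-y-xᵐyʲ m j

  proj₁-prod : ∀ {U} → All XorY U → proj₁ (prod U) ≡ 2 ^ occurrences y U % p
  proj₁-prod [] = sym (m<n⇒m%n≡m 1<p)
  proj₁-prod {_ ∷ U} (inj₁ refl ∷ U∈xy) = begin
    1 * proj₁ (prod U) % p            ≡⟨ cong (_% p) (*-identityˡ _) ⟩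
    proj₁ (prod U) % p                ≡⟨ cong (_% p) (proj₁-prod U∈xy) ⟩
    2 ^ occurrences y U % p % p       ≡⟨ m%n%n≡m%n _ p ⟩
    2 ^ occurrences y U % p           ∎
  proj₁-prod {_ ∷ U} (inj₂ refl ∷ U∈xy) = begin
    2 * proj₁ (prod U) % p            ≡⟨ cong (λ k → 2 * k % p) (proj₁-prod U∈xy) ⟩
    2 * (2 ^ occurrences y U % p) % p ≡⟨ m*[n%d]%d≡m*n%d 2 _ ⟩
    2 ^ suc (occurrences y U) % p     ∎

  prod-xᵏ : ∀ {U} → All (_≡ x) U → prod U ≡ (1 , length U % p)
  prod-xᵏ [] = cong (1 ,_) (sym (m<n⇒m%n≡m (≤-trans (s≤s z≤n) 1<p)))
  prod-xᵏ {_ ∷ U} (refl ∷ U≡x) = begin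
    holMul p x (prod U)                     ≡⟨ cong (holMul p x) (prod-xᵏ U≡x) ⟩
    1 % p , (1 * (length U % p) + 1) % p    ≡⟨ cong₂ _,_ (m<n⇒m%n≡m 1<p) lastCoordinate ⟩
    1 , suc (length U) % p                  ∎
    where
    lastCoordinate : (1 * (length U % p) + 1) % p ≡ suc (length U) % p
    lastCoordinate = begin
      (1 * (length U % p) + 1) % p ≡⟨ cong (λ k → (k + 1) % p) (*-identityˡ _) ⟩
      (length U % p + 1) % p       ≡⟨ [m%d+n]%d≡[m+n]%d (length U) 1 ⟩
      (length U + 1) % p           ≡⟨ cong (_% p) (+-comm (length U) 1) ⟩
      suc (length U) % p           ∎

  no-y⇒all-x : ∀ {U} → All XorY U → occurrences y U ≡ 0 → All (_≡ x) U
  no-y⇒all-x [] _ = []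
  no-y⇒all-x (inj₁ refl ∷ U∈xy) none = refl ∷ no-y⇒all-x U∈xy none
  no-y⇒all-x (inj₂ refl ∷ U∈xy) ()

  module _ {j : ℕ} (order : OrderOf2Above p j) where

    productOne⊆xᵐyʲ⇒all-x : ∀ {m T} → T ⊆ xᵐyʲ m j → ProductOne T → All (_≡ x) T
    productOne⊆xᵐyʲ⇒all-x {m} {T} q (U , U↭T , prodU≡e) =
      All-resp-↭ U↭T (no-y⇒all-x U∈xy (order fewY (≡-trans (sym (proj₁-prod U∈xy)) (cong proj₁ prodU≡e))))
      where
      U∈xy : All XorY U
      U∈xy = All-resp-↭ (↭-sym U↭T) (All-resp-⊆ q (xᵐyʲ-XorY m j))
      fewY : occurrences y U ≤ j
      fewY = subst (_≤ j) (sym (occurrences-↭ y U↭T))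
                   (subst (occurrences y T ≤_) (occurrences-y-xᵐyʲ m j) (occurrences-⊆ y q))

    productOne⊆xᵐyʲ⇒p≤length≤m : ∀ {m T} → T ⊆ xᵐyʲ m j → 1 ≤ length T → ProductOne T →
                                 p ≤ length T × length T ≤ m
    productOne⊆xᵐyʲ⇒p≤length≤m {m} {T} q 1≤|T| po@(U , U↭T , prodU≡e) = p≤|T| , |T|≤m
      where
      T≡x : All (_≡ x) T
      T≡x = productOne⊆xᵐyʲ⇒all-x q po
      |U|≡|T| : length U ≡ length T
      |U|≡|T| = ↭-length U↭T
      |U|%p≡0 : length U % p ≡ 0
      |U|%p≡0 = cong proj₂ (≡-trans (sym (prod-xᵏ (All-resp-↭ (↭-sym U↭T) T≡x))) prodU≡e)
      p≤|T| : p ≤ length T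
      p≤|T| = n%d≡0⇒d≤n (length T) {{>-nonZero 1≤|T|}} (subst (λ n → n % p ≡ 0) |U|≡|T| |U|%p≡0)
      |T|≤m : length T ≤ m
      |T|≤m = subst (_≤ m) (cong length (filter-all (_≟ₕ x) T≡x))
                    (subst (occurrences x T ≤_) (occurrences-x-xᵐyʲ m j) (occurrences-⊆ x q))

    davenport-lower-bound : ∀ n → DavenportProp n → p + j ≤ n
    davenport-lower-bound n D with p + j ≤? n
    ... | yes p+j≤n = p+j≤n
    ... | no p+j≰n with D (take n (xᵐyʲ (pred p) j)) (take⁺ n (xᵐyʲ-∈G (pred p) j)) |S|
      where
      n≤pred[p]+j : n ≤ pred p + j
      n≤pred[p]+j = ≤-pred (subst (n <_) (cong (_+ j) (sym (suc-pred p))) (≰⇒> p+j≰n))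
      |S| : length (take n (xᵐyʲ (pred p) j)) ≡ n
      |S| = ≡-trans (length-take n _) (m≤n⇒m⊓n≡m (subst (n ≤_) (sym (length-xᵐyʲ (pred p) j)) n≤pred[p]+j))
    ... | T , q , 1≤|T| , po with productOne⊆xᵐyʲ⇒p≤length≤m (⊆-trans q (take-⊆ n _)) 1≤|T| po
    ... | p≤|T| , |T|≤pred[p] = ⊥-elim (<⇒≱ (m≤pred[n]⇒suc[m]≤n |T|≤pred[p]) p≤|T|)

    f-lower-bound : ∀ k → ShortProp (p + j) k → p ≤ k
    f-lower-bound k short with short (xᵐyʲ p j) (xᵐyʲ-∈G p j) (length-xᵐyʲ p j)
    ... | T , q , 1≤|T| , |T|≤k , po = ≤-trans (proj₁ (productOne⊆xᵐyʲ⇒p≤length≤m q 1≤|T| po)) |T|≤k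

hol-davenport-and-f : (p : ℕ) .{{_ : NonZero p}} → 2 < p → (j : ℕ) → OrderOf2Above p j →
                      T (HolSearch.everyMultisetHasShort p (p + j) p) →
                      (∃[ d ] DavenportHol p d) × (∀ d → DavenportHol p d → FHol p d p)
hol-davenport-and-f p 2<p j order searchSucceeds =
  (p + j , isDavenport) , λ d D → subst (λ d → FHol p d p) (IsDavenport-unique isDavenport D) isF
  where
  open ProductOneTheory (HolElem p) (holMul p) (holOne p)
  open ProductOneFacts (HolElem p) (holMul p) (holOne p)
  open HolLowerBound p 2<p
  1≤p : 1 ≤ p
  1≤p = <⇒≤ 1<p
  short : ShortProp (p + j) p
  short = HolSearch.shortProp-by-enumeration p (p + j) p searchSucceeds
  isDavenport : DavenportHol p (p + j)
  isDavenport = ≤-trans 1≤p (m≤m+n p j) , ShortProp⇒DavenportProp short , λ n _ → davenport-lower-bound order n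
  isF : FHol p (p + j) p
  isF = 1≤p , short , λ k _ → f-lower-bound order k

order-2-mod-3 : OrderOf2Above 3 1
order-2-mod-3 {zero} _ _ = refl
order-2-mod-3 {suc zero} _ ()
order-2-mod-3 {suc (suc _)} (s≤s ()) _

order-2-mod-5 : OrderOf2Above 5 3
order-2-mod-5 {zero} _ _ = refl
order-2-mod-5 {suc zero} _ ()
order-2-mod-5 {suc (suc zero)} _ ()
order-2-mod-5 {suc (suc (suc zero))} _ ()
order-2-mod-5 {suc (suc (suc (suc _)))} (s≤s (s≤s (s≤s ()))) _

proposition5p1 : (p : ℕ) .{{_ : NonZero p}} → p ≡ 3 ⊎ p ≡ 5 →
    (∃[ d ] DavenportHol p d) × (∀ d → DavenportHol p d → FHol p d p)
-- The last argument lives in T b for a closed boolean b; the exhaustive search runs when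
-- the type checker reduces b to true and solves it.
proposition5p1 .3 (inj₁ refl) = hol-davenport-and-f 3 (s≤s (s≤s (s≤s z≤n))) 1 order-2-mod-3 _
proposition5p1 .5 (inj₂ refl) = hol-davenport-and-f 5 (s≤s (s≤s (s≤s z≤n))) 3 order-2-mod-5 _
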